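{- Let $Z$ be a $z$-tree with $k$ edges. Then for all $n\ge k+1$, ${\rm ex}_{\rightarrow}(n,Z)=(k-1)n-\binom{k}{2}$.
   Context: An ordered graph is a graph with a linearly ordered vertex set; an $n$-vertex ordered graph has vertex set $[n]$ with the natural order. An ordered graph $F$ is contained in an ordered graph $G$ if there is an injective order-preserving map $V(F)\to V(G)$ mapping edges to edges. ${\rm ex}_{\rightarrow}(n,F)$ is the maximum number of edges in an $n$-vertex ordered graph not containing $F$. The length of an edge $ij$ is $|i-j|$. An increasing tree is an ordered tree defined recursively: a single edge is an increasing tree; given an increasing tree whose vertices are split into intervals $I<J$ (all edges go between $I$ and $J$) with longest edge $ij$, $i\in I$, $j\in J$ (here $i$ is the first and $j$ the last vertex of the tree), one obtains an increasing tree with one more edge by adding a new vertex $j'>j$ to $J$ with the edge $ij'$, or a new vertex $i'<i$ to $I$ with the edge $i'j$. A $z$-tree is an ordered tree $Z$ with interval chromatic number two, with parts intervals $I<J$, that is the union of an increasing tree $T$ with longest edge $ij$ ($i\in I$, $j\in J$) together with a (possibly empty) set $S_j$ of edges $hj$ where each $h\in I$ is a new vertex with $h<i$, and a (possibly empty) set $S_i$ of edges $ik$ where each $k\in J$ is a new vertex with $k>j$. (The interval chromatic number of an ordered graph is the least $m$ such that its vertex set can be partitioned into intervals $A_1<\dots<A_m$ with no edge inside any $A_t$.) -}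

module Defs where

open import Data.Nat using (ℕ; zero; suc; _+_; _*_; _∸_; _≤_; _<_; _≡ᵇ_)
open import Data.Nat.Combinatorics using (_C_)
open import Data.Bool using (Bool; true; false; _∧_; _∨_; if_then_else_)
open import Data.Fin using (Fin; toℕ) renaming (_<_ to _<ᶠ_; _<?_ to _<ᶠ?_)
open import Data.Nat.ListAction using (sum)
open import Data.List using (List; []; _∷_; map; length; allFin; cartesianProduct; upTo; _++_)
open import Data.Product using (Σ; _×_; _,_; ∃)
open import Relation.Nullary using (¬_; does)
open import Relation.Binary.PropositionalEquality using (_≡_)

-- An ordered graph is given by an adjacency function; only the entries
-- G i j with i < j are meaningful (the edge {i,j} with i < j is present
-- iff G i j ≡ true).  All other entries are ignored.

OGraph : ℕ → Set
OGraph n = Fin n → Fin n → Bool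

Edge : ∀ {n} → OGraph n → Fin n → Fin n → Set
Edge G i j = (i <ᶠ j) × (G i j ≡ true)

edgeCount : ∀ {n} → OGraph n → ℕ
edgeCount {n} G =
  sum (map (λ p → count1 (proj1 p) (proj2 p)) (cartesianProduct (allFin n) (allFin n)))
  where
    proj1 : Fin n × Fin n → Fin n
    proj1 (i , _) = i
    proj2 : Fin n × Fin n → Fin n
    proj2 (_ , j) = j
    count1 : Fin n → Fin n → ℕ
    count1 i j = if does (i <ᶠ? j) ∧ G i j then 1 else 0

Contains : ∀ {m n} → OGraph m → OGraph n → Set
Contains {m} {n} F G =
  Σ (Fin m → Fin n) λ f →
    (∀ i j → i <ᶠ j → f i <ᶠ f j) ×
    (∀ i j → Edge F i j → Edge G (f i) (f j))

IsEx : ∀ {m} → ℕ → OGraph m → ℕ → Set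
IsEx n F M =
  (∃ λ (G : OGraph n) → (¬ Contains F G) × (edgeCount G ≡ M)) ×
  (∀ (G : OGraph n) → ¬ Contains F G → edgeCount G ≤ M)

-- Edge lists over ℕ (pairs (x , y) with x < y) and the ordered graph
-- they induce on Fin N.

hasEdge : List (ℕ × ℕ) → ℕ → ℕ → Bool
hasEdge [] x y = false
hasEdge ((u , v) ∷ es) x y = ((u ≡ᵇ x) ∧ (v ≡ᵇ y)) ∨ hasEdge es x y

graphOf : (N : ℕ) → List (ℕ × ℕ) → OGraph N
graphOf N es i j = hasEdge es (toℕ i) (toℕ j)

shift : ℕ → List (ℕ × ℕ) → List (ℕ × ℕ)
shift a = map (λ { (u , v) → (a + u , a + v) })

-- The current tree has vertices 0 , … , m-1 with
-- first vertex i = 0 and last vertex j = m-1, and its longest edge is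
-- ij.  A step either
--   addJ : adds a new last vertex j' = m (> j) with the edge i j', or
--   addI : adds a new first vertex i' (< i) with the edge i' j
--          (all old vertices are shifted up by one).
-- A word of steps is listed with the most recent step first.

data Step : Set where
  addI addJ : Step

incSize : List Step → ℕ
incSize w = 2 + length w

incEdges : List Step → List (ℕ × ℕ)
incEdges [] = (0 , 1) ∷ []
incEdges (addJ ∷ w) = (0 , incSize w) ∷ incEdges w
incEdges (addI ∷ w) = (0 , incSize w) ∷ shift 1 (incEdges w)

-- An increasing tree T (word w, m = incSize w vertices) with
--   a new vertices h < i, each joined to j   (the set S_j), and
--   b new vertices k > j, each joined to i   (the set S_i).
-- Vertices: 0..a-1 are the h's, a..a+m-1 are T (i = a, j = a+m-1),
-- a+m..a+m+b-1 are the k's.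

zSize : List Step → ℕ → ℕ → ℕ
zSize w a b = a + incSize w + b

zEdges : List Step → ℕ → ℕ → List (ℕ × ℕ)
zEdges w a b =
  shift a (incEdges w)
  ++ map (λ h → (h , a + incSize w ∸ 1)) (upTo a)
  ++ map (λ t → (a , a + incSize w + t)) (upTo b)

zTree : (w : List Step) (a b : ℕ) → OGraph (zSize w a b)
zTree w a b = graphOf (zSize w a b) (zEdges w a b)

module Submission where

-- Upper bound.  Z is obtained from a single edge by repeatedly adding a
-- new last vertex joined to some v that is adjacent to the old last
-- vertex ("right extension"), or a new first vertex joined to some v
-- adjacent to the old first vertex ("left extension").  If P arises
-- from P′ (on ℓ + 1 vertices) by a right extension and G avoids P,
-- delete, for each of the n - ℓ vertices x in a suitable window, the
-- longest edge going right from x.  The rest avoids P′, since any copy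
-- of P′ could be completed to a copy of P through a deleted edge.  Hence
-- ex→(n, P) ≤ ex→(n, P′) + (n - ℓ), and (k - 1) n - C(k, 2) satisfies
-- exactly this recursion.  Left extensions are the mirror image.
--
-- Lower bound.  Z has an edge between two consecutive vertices with p
-- vertices before and q after it, p + q + 2 = k + 1.  The graph of all
-- pairs x < y with x among the first p or y among the last q vertices
-- has (k - 1) n - C(k, 2) edges and cannot contain Z.

open import Defs
open import Data.Nat using (ℕ; zero; suc; _+_; _*_; _∸_; _≤_; _<_; _≮_; _≡ᵇ_; _<ᵇ_; z≤n; s≤s)
open import Data.Nat.Properties
open import Data.Nat.Combinatorics using (_C_; nC1≡n; nCk+nC[k+1]≡[n+1]C[k+1])
open import Data.Nat.Solver using (module +-*-Solver)
open import Data.Nat.ListAction using (sum)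
open import Data.Nat.ListAction.Properties using (sum-++)
open import Algebra.Properties.CommutativeSemigroup +-commutativeSemigroup
  using () renaming (interchange to +-interchange)
open import Algebra.Properties.CommutativeMonoid.Sum +-0-commutativeMonoid
  using (sum-syntax; ∑-comm; ∑-distrib-+; sum-cong-≗; sum-replicate-zero) renaming (sum to ∑)
open import Data.List using (List; []; _∷_; map; length; allFin; cartesianProduct; upTo; _++_; tabulate)
open import Data.List.Properties using (map-++; map-∘)
open import Data.List.Membership.Propositional using (_∈_)
open import Data.List.Membership.Propositional.Properties using (∈-map⁺; ∈-map⁻; ∈-++⁺ˡ; ∈-++⁺ʳ; ∈-++⁻; ∈-upTo⁺; ∈-upTo⁻)
open import Data.List.Relation.Unary.Any using (here; there)
open import Data.Bool using (Bool; true; false; _∧_; _∨_; not; if_then_else_)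
open import Data.Bool.Properties using (T-≡; ∨-zeroʳ; ∧-zeroʳ)
open import Data.Fin using (Fin; toℕ) renaming (zero to fzero; suc to fsuc; _<_ to _<ᶠ_)
open import Data.Fin.Properties using (toℕ<n; toℕ-injective) renaming (suc-injective to fsuc-injective)
open import Data.Product using (Σ; _×_; _,_; proj₁; proj₂)
open import Data.Sum using (_⊎_; inj₁; inj₂)
open import Data.Empty using (⊥; ⊥-elim)
open import Relation.Nullary using (¬_)
open import Relation.Binary.Definitions using (tri<; tri≈; tri>)
open import Relation.Binary.PropositionalEquality using (_≡_; refl; sym; trans; cong; cong₂; subst; subst₂; module ≡-Reasoning)
open import Function using (_∘_; Equivalence)

ind : Bool → ℕ
ind b = if b then 1 else 0

true≢false : ∀ {b} → b ≡ true → b ≡ false → ⊥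
true≢false refl ()

bool-ext : ∀ {b c : Bool} → (b ≡ true → c ≡ true) → (c ≡ true → b ≡ true) → b ≡ c
bool-ext {false} {false} _ _ = refl
bool-ext {false} {true}  _ g = g refl
bool-ext {true}  {false} f _ = sym (f refl)
bool-ext {true}  {true}  _ _ = refl

∧-elimˡ : ∀ {a b} → a ∧ b ≡ true → a ≡ true
∧-elimˡ {true} _ = refl

∧-elimʳ : ∀ {a b} → a ∧ b ≡ true → b ≡ true
∧-elimʳ {true} e = e

∧-intro : ∀ {a b} → a ≡ true → b ≡ true → a ∧ b ≡ true
∧-intro refl refl = refl

∨-introʳ : ∀ a {b} → b ≡ true → a ∨ b ≡ true
∨-introʳ a refl = ∨-zeroʳ a

not-true : ∀ {b} → not b ≡ true → b ≡ false
not-true {false} _ = refl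

<ᵇ⇒<′ : ∀ {m n} → (m <ᵇ n) ≡ true → m < n
<ᵇ⇒<′ {m} {n} e = <ᵇ⇒< m n (Equivalence.from T-≡ e)

<⇒<ᵇ′ : ∀ {m n} → m < n → (m <ᵇ n) ≡ true
<⇒<ᵇ′ m<n = Equivalence.to T-≡ (<⇒<ᵇ m<n)

≮⇒<ᵇ-false : ∀ {m n} → m ≮ n → (m <ᵇ n) ≡ false
≮⇒<ᵇ-false {m} {n} m≮n with m <ᵇ n in eq
... | true  = ⊥-elim (m≮n (<ᵇ⇒<′ eq))
... | false = refl

∑-mono : ∀ n {f g : Fin n → ℕ} → (∀ i → f i ≤ g i) → ∑ f ≤ ∑ g
∑-mono zero    _ = z≤n
∑-mono (suc n) h = +-mono-≤ (h fzero) (∑-mono n (h ∘ fsuc))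

∑-zero : ∀ n {f : Fin n → ℕ} → (∀ i → f i ≡ 0) → ∑ f ≡ 0
∑-zero n h = trans (sum-cong-≗ h) (sum-replicate-zero n)

∑-ind-atMostOne : ∀ n (Q : Fin n → Bool) → (∀ i j → Q i ≡ true → Q j ≡ true → i ≡ j) →
  ∑[ j < n ] ind (Q j) ≤ 1
∑-ind-atMostOne zero    Q uniq = z≤n
∑-ind-atMostOne (suc n) Q uniq with Q fzero in q0
... | true  = ≤-reflexive (cong suc (∑-zero n rest))
  where
  rest : ∀ i → ind (Q (fsuc i)) ≡ 0
  rest i with Q (fsuc i) in qi
  ... | true with () ← uniq fzero (fsuc i) q0 qi
  ... | false = refl
... | false = ∑-ind-atMostOne n (Q ∘ fsuc) (λ i j qi qj → fsuc-injective (uniq (fsuc i) (fsuc j) qi qj))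

sumBelow : ℕ → (ℕ → ℕ) → ℕ
sumBelow n g = ∑[ i < n ] g (toℕ i)

sumBelow-cong : ∀ n {g h : ℕ → ℕ} → (∀ i → i < n → g i ≡ h i) → sumBelow n g ≡ sumBelow n h
sumBelow-cong n eq = sum-cong-≗ (λ i → eq (toℕ i) (toℕ<n i))

sumBelow-zero : ∀ n {g : ℕ → ℕ} → (∀ i → i < n → g i ≡ 0) → sumBelow n g ≡ 0
sumBelow-zero n eq = ∑-zero n (λ i → eq (toℕ i) (toℕ<n i))

sumBelow-last : ∀ n (g : ℕ → ℕ) → sumBelow (suc n) g ≡ sumBelow n g + g n
sumBelow-last zero    g = +-comm (g 0) 0
sumBelow-last (suc n) g = trans (cong (g 0 +_) (sumBelow-last n (g ∘ suc))) (sym (+-assoc (g 0) _ _))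

sumBelow-+ : ∀ n (g h : ℕ → ℕ) → sumBelow n (λ i → g i + h i) ≡ sumBelow n g + sumBelow n h
sumBelow-+ n g h = ∑-distrib-+ {n} (g ∘ toℕ) (h ∘ toℕ)

sumBelow-ones : ∀ n → sumBelow n (λ _ → 1) ≡ n
sumBelow-ones zero    = refl
sumBelow-ones (suc n) = cong suc (sumBelow-ones n)

sumBelow-ind-unique : ∀ n (Q : ℕ → Bool) v → v < n → Q v ≡ true →
  (∀ j → j < n → Q j ≡ true → j ≡ v) → sumBelow n (λ j → ind (Q j)) ≡ 1
sumBelow-ind-unique (suc n) Q zero _ q0 uniq rewrite q0 = cong suc (sumBelow-zero n rest)
  where
  rest : ∀ i → i < n → ind (Q (suc i)) ≡ 0
  rest i i<n with Q (suc i) in qi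
  ... | true with () ← uniq (suc i) (s≤s i<n) qi
  ... | false = refl
sumBelow-ind-unique (suc n) Q (suc v) (s≤s v<n) qv uniq with Q 0 in q0
... | true with () ← uniq 0 (s≤s z≤n) q0
... | false = sumBelow-ind-unique n (Q ∘ suc) v v<n qv
                (λ j j<n qj → suc-injective (uniq (suc j) (s≤s j<n) qj))

count-below : ∀ n hi → sumBelow n (λ i → ind (i <ᵇ hi)) ≤ hi
count-below zero    hi       = z≤n
count-below (suc n) zero     = ≤-reflexive (sumBelow-zero n (λ _ _ → refl))
count-below (suc n) (suc hi) = s≤s (count-below n hi)

count-atLeast : ∀ n lo → sumBelow n (λ i → ind (not (i <ᵇ lo))) ≡ n ∸ lo
count-atLeast zero    lo       = sym (0∸n≡0 lo)
count-atLeast (suc n) zero     = sumBelow-ones (suc n)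
count-atLeast (suc n) (suc lo) = count-atLeast n lo

inWindow : ℕ → ℕ → ℕ → Bool
inWindow lo hi i = not (i <ᵇ lo) ∧ (i <ᵇ hi)

count-window : ∀ n lo hi → sumBelow n (λ i → ind (inWindow lo hi i)) ≤ hi ∸ lo
count-window n       zero     hi       = count-below n hi
count-window zero    (suc lo) hi       = z≤n
count-window (suc n) (suc lo) zero     =
  ≤-reflexive (sumBelow-zero (suc n) (λ i _ → cong ind (∧-zeroʳ (not (i <ᵇ suc lo)))))
count-window (suc n) (suc lo) (suc hi) = count-window n lo hi

sum-cartesianProduct : ∀ {A B : Set} (xs : List A) (ys : List B) (h : A × B → ℕ) →
  sum (map h (cartesianProduct xs ys)) ≡ sum (map (λ x → sum (map (λ y → h (x , y)) ys)) xs)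
sum-cartesianProduct []       ys h = refl
sum-cartesianProduct (x ∷ xs) ys h = begin
  sum (map h (map (x ,_) ys ++ cartesianProduct xs ys))
    ≡⟨ cong sum (map-++ h (map (x ,_) ys) _) ⟩
  sum (map h (map (x ,_) ys) ++ map h (cartesianProduct xs ys))
    ≡⟨ sum-++ (map h (map (x ,_) ys)) _ ⟩
  sum (map h (map (x ,_) ys)) + sum (map h (cartesianProduct xs ys))
    ≡⟨ cong₂ _+_ (cong sum (sym (map-∘ ys))) (sum-cartesianProduct xs ys h) ⟩
  sum (map (λ y → h (x , y)) ys) + sum (map (λ x → sum (map (λ y → h (x , y)) ys)) xs) ∎
  where open ≡-Reasoning

sum-tabulate : ∀ {A : Set} n (f : Fin n → A) (h : A → ℕ) → sum (map h (tabulate f)) ≡ ∑ (h ∘ f)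
sum-tabulate zero    f h = refl
sum-tabulate (suc n) f h = cong (h (f fzero) +_) (sum-tabulate n (f ∘ fsuc) h)

edgeCount-∑ : ∀ {n} (G : OGraph n) →
  edgeCount G ≡ ∑[ i < n ] ∑[ j < n ] ind ((toℕ i <ᵇ toℕ j) ∧ G i j)
edgeCount-∑ {n} G = trans (sum-cartesianProduct (allFin n) (allFin n) _)
  (trans (sum-tabulate n (λ i → i) _) (sum-cong-≗ {n} (λ i → sum-tabulate n (λ j → j) _)))

-- A pattern is an adjacency relation on ℕ; only pairs x < y matter.
Pattern : Set
Pattern = ℕ → ℕ → Bool

restrict : (N : ℕ) → Pattern → OGraph N
restrict N P x y = P (toℕ x) (toℕ y)

pairCount : ℕ → Pattern → ℕ
pairCount N P = sumBelow N (λ i → sumBelow N (λ j → ind ((i <ᵇ j) ∧ P i j)))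

edgeCount-restrict : ∀ N P → edgeCount (restrict N P) ≡ pairCount N P
edgeCount-restrict N P = edgeCount-∑ (restrict N P)

pairCount-cong : ∀ N {P Q : Pattern} → (∀ i j → j < N → P i j ≡ Q i j) → pairCount N P ≡ pairCount N Q
pairCount-cong N eq =
  sumBelow-cong N (λ i _ → sumBelow-cong N (λ j j<N → cong (λ b → ind ((i <ᵇ j) ∧ b)) (eq i j j<N)))

pairCount-peel : ∀ N P → pairCount (suc N) P ≡
  sumBelow N (λ j → ind (P 0 (suc j))) + pairCount N (λ i j → P (suc i) (suc j))
pairCount-peel N P = refl

pairCount-last : ∀ N P → pairCount (suc N) P ≡ pairCount N P + sumBelow N (λ i → ind (P i N))
pairCount-last N P = begin
  pairCount (suc N) P
    ≡⟨ sumBelow-last N (λ i → sumBelow (suc N) (c i)) ⟩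
  sumBelow N (λ i → sumBelow (suc N) (c i)) + sumBelow (suc N) (c N)
    ≡⟨ cong₂ _+_ (sumBelow-cong N (λ i _ → sumBelow-last N (c i))) (sumBelow-zero (suc N) lastRow) ⟩
  sumBelow N (λ i → sumBelow N (c i) + c i N) + 0
    ≡⟨ trans (+-identityʳ _) (sumBelow-+ N (λ i → sumBelow N (c i)) (λ i → c i N)) ⟩
  pairCount N P + sumBelow N (λ i → c i N)
    ≡⟨ cong (pairCount N P +_) (sumBelow-cong N (λ i i<N → cong (λ b → ind (b ∧ P i N)) (<⇒<ᵇ′ i<N))) ⟩
  pairCount N P + sumBelow N (λ i → ind (P i N)) ∎
  where
  open ≡-Reasoning
  c : ℕ → ℕ → ℕ
  c i j = ind ((i <ᵇ j) ∧ P i j)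
  lastRow : ∀ j → j < suc N → c N j ≡ 0
  lastRow j (s≤s j≤N) = cong (λ b → ind (b ∧ P N j)) (≮⇒<ᵇ-false (≤⇒≯ j≤N))

pairCount-complete : ∀ N → pairCount N (λ _ _ → true) ≡ N C 2
pairCount-complete zero    = refl
pairCount-complete (suc N) = begin
  sumBelow N (λ _ → 1) + pairCount N (λ _ _ → true) ≡⟨ cong₂ _+_ (sumBelow-ones N) (pairCount-complete N) ⟩
  N + N C 2                                         ≡⟨ cong (_+ N C 2) (sym (nC1≡n N)) ⟩
  N C 1 + N C 2                                     ≡⟨ nCk+nC[k+1]≡[n+1]C[k+1] N 1 ⟩
  suc N C 2                                         ∎
  where open ≡-Reasoning

IncreasingOn : ∀ {n} → ℕ → (ℕ → Fin n) → Set
IncreasingOn N ψ = ∀ u w → u < w → w < N → toℕ (ψ u) < toℕ (ψ w)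

IsCopy : ℕ → Pattern → ∀ {n} → OGraph n → (ℕ → Fin n) → Set
IsCopy N P G ψ = IncreasingOn N ψ ×
  (∀ u w → u < w → w < N → P u w ≡ true → G (ψ u) (ψ w) ≡ true)

Embeds : ℕ → Pattern → ∀ {n} → OGraph n → Set
Embeds N P {n} G = Σ (ℕ → Fin n) (IsCopy N P G)

Embeds⇒Contains : ∀ N P {n} (G : OGraph n) → Embeds N P G → Contains (restrict N P) G
Embeds⇒Contains N P G (ψ , incr , edges) =
  (λ i → ψ (toℕ i)) ,
  (λ i j i<j → incr (toℕ i) (toℕ j) i<j (toℕ<n j)) ,
  (λ i j (i<j , e) → incr (toℕ i) (toℕ j) i<j (toℕ<n j) , edges (toℕ i) (toℕ j) i<j (toℕ<n j) e)

clamp : (N : ℕ) → ℕ → Fin (suc N)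
clamp zero    _       = fzero
clamp (suc N) zero    = fzero
clamp (suc N) (suc u) = fsuc (clamp N u)

toℕ-clamp : ∀ N u → u ≤ N → toℕ (clamp N u) ≡ u
toℕ-clamp zero    zero    _       = refl
toℕ-clamp (suc N) zero    _       = refl
toℕ-clamp (suc N) (suc u) (s≤s h) = cong suc (toℕ-clamp N u h)

Contains⇒Embeds : ∀ N P {n} (G : OGraph n) → Contains (restrict (suc N) P) G → Embeds (suc N) P G
Contains⇒Embeds N P G (φ , mono , edges) = φ ∘ clamp N , incr , edges′
  where
  toℕ-clamp< : ∀ {u} → u < suc N → toℕ (clamp N u) ≡ u
  toℕ-clamp< u<1+N = toℕ-clamp N _ (≤-pred u<1+N)
  clamp-< : ∀ {u w} → u < w → w < suc N → clamp N u <ᶠ clamp N w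
  clamp-< u<w w<1+N = subst₂ _<_ (sym (toℕ-clamp< (<-trans u<w w<1+N))) (sym (toℕ-clamp< w<1+N)) u<w
  incr : IncreasingOn (suc N) (φ ∘ clamp N)
  incr u w u<w w<1+N = mono (clamp N u) (clamp N w) (clamp-< u<w w<1+N)
  edges′ : ∀ u w → u < w → w < suc N → P u w ≡ true → G (φ (clamp N u)) (φ (clamp N w)) ≡ true
  edges′ u w u<w w<1+N Puw = proj₂ (edges (clamp N u) (clamp N w) (clamp-< u<w w<1+N ,
    subst₂ (λ a b → P a b ≡ true) (sym (toℕ-clamp< (<-trans u<w w<1+N))) (sym (toℕ-clamp< w<1+N)) Puw))

module _ {N n : ℕ} {ψ : ℕ → Fin n} (incr : IncreasingOn N ψ) where

  increasing-≥ : ∀ u → u < N → u ≤ toℕ (ψ u)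
  increasing-≥ zero    _     = z≤n
  increasing-≥ (suc u) 1+u<N =
    ≤-trans (s≤s (increasing-≥ u (<-trans (n<1+n u) 1+u<N))) (incr u (suc u) (n<1+n u) 1+u<N)

  increasing-gap : ∀ d u → u + d < N → toℕ (ψ u) + d ≤ toℕ (ψ (u + d))
  increasing-gap zero u _ =
    ≤-reflexive (trans (+-identityʳ _) (cong (toℕ ∘ ψ) (sym (+-identityʳ u))))
  increasing-gap (suc d) u u+d<N = begin
    toℕ (ψ u) + suc d     ≡⟨ +-suc (toℕ (ψ u)) d ⟩
    suc (toℕ (ψ u)) + d   ≤⟨ +-monoˡ-≤ d (incr u (suc u) (n<1+n u) 1+u<N) ⟩
    toℕ (ψ (suc u)) + d   ≤⟨ increasing-gap d (suc u) 1+u+d<N ⟩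
    toℕ (ψ (suc u + d))   ≡⟨ cong (toℕ ∘ ψ) (sym (+-suc u d)) ⟩
    toℕ (ψ (u + suc d))   ∎
    where
    open ≤-Reasoning
    1+u+d<N : suc u + d < N
    1+u+d<N = subst (_< N) (+-suc u d) u+d<N
    1+u<N : suc u < N
    1+u<N = ≤-trans (s≤s (s≤s (m≤m+n u d))) 1+u+d<N

  increasing-≤ : ∀ u w → u ≤ w → w < N → toℕ (ψ u) ≤ toℕ (ψ w)
  increasing-≤ u w u≤w w<N with m≤n⇒m<n∨m≡n u≤w
  ... | inj₁ u<w  = <⇒≤ (incr u w u<w w<N)
  ... | inj₂ refl = ≤-refl

record LeftExtension (N′ : ℕ) (P′ P : Pattern) (v : ℕ) : Set where
  field
    old     : ∀ i j → P (suc i) (suc j) ≡ P′ i j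
    newOnly : ∀ j → j < N′ → P 0 (suc j) ≡ true → j ≡ v
    newEdge : P 0 (suc v) ≡ true
    v<N′    : v < N′
    0<v     : 0 < v
    anchor  : P′ 0 v ≡ true

record RightExtension (N′ : ℕ) (P′ P : Pattern) (v : ℕ) : Set where
  field
    old     : ∀ i j → j < N′ → P i j ≡ P′ i j
    newOnly : ∀ i → i < N′ → P i N′ ≡ true → i ≡ v
    newEdge : P v N′ ≡ true
    1+v<N′  : suc v < N′
    anchor  : P′ v (N′ ∸ 1) ≡ true

leftExtension-pairCount : ∀ {N′ P′ P v} → LeftExtension N′ P′ P v →
  pairCount (suc N′) P ≡ pairCount N′ P′ + 1
leftExtension-pairCount {N′} {P′} {P} {v} ext = begin
  pairCount (suc N′) P ≡⟨ pairCount-peel N′ P ⟩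
  sumBelow N′ (λ j → ind (P 0 (suc j))) + pairCount N′ (λ i j → P (suc i) (suc j))
    ≡⟨ cong₂ _+_ (sumBelow-ind-unique N′ (λ j → P 0 (suc j)) v v<N′ newEdge newOnly)
                 (pairCount-cong N′ (λ i j _ → old i j)) ⟩
  1 + pairCount N′ P′ ≡⟨ +-comm 1 _ ⟩
  pairCount N′ P′ + 1 ∎
  where open ≡-Reasoning
        open LeftExtension ext

rightExtension-pairCount : ∀ {N′ P′ P v} → RightExtension N′ P′ P v →
  pairCount (suc N′) P ≡ pairCount N′ P′ + 1
rightExtension-pairCount {N′} {P′} {P} {v} ext = begin
  pairCount (suc N′) P ≡⟨ pairCount-last N′ P ⟩
  pairCount N′ P + sumBelow N′ (λ i → ind (P i N′))
    ≡⟨ cong₂ _+_ (pairCount-cong N′ old)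
                 (sumBelow-ind-unique N′ (λ i → P i N′) v (<-trans (n<1+n v) 1+v<N′) newEdge newOnly) ⟩
  pairCount N′ P′ + 1 ∎
  where open ≡-Reasoning
        open RightExtension ext

-- Deleting longest edges

anyFin : ∀ {n} → (Fin n → Bool) → Bool
anyFin {zero}  f = false
anyFin {suc n} f = f fzero ∨ anyFin (f ∘ fsuc)

anyFin-sound : ∀ {n} (f : Fin n → Bool) → anyFin f ≡ true → Σ (Fin n) λ i → f i ≡ true
anyFin-sound {suc n} f h with f fzero in e
... | true  = fzero , e
... | false with anyFin-sound (f ∘ fsuc) h
...   | i , e′ = fsuc i , e′

anyFin-complete : ∀ {n} (f : Fin n → Bool) i → f i ≡ true → anyFin f ≡ true
anyFin-complete f fzero    e rewrite e = refl
anyFin-complete f (fsuc i) e = ∨-introʳ (f fzero) (anyFin-complete (f ∘ fsuc) i e)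

delete : ∀ {n} → OGraph n → (Fin n → Fin n → Bool) → OGraph n
delete G D x y = G x y ∧ not (D x y)

delete-⊆ : ∀ {n} (G : OGraph n) D x y → delete G D x y ≡ true → G x y ≡ true
delete-⊆ G D x y = ∧-elimˡ

ind-delete : ∀ a g d → ind (a ∧ g) ≤ ind (a ∧ (g ∧ not d)) + ind d
ind-delete false g     d     = z≤n
ind-delete true  false d     = z≤n
ind-delete true  true  false = ≤-refl
ind-delete true  true  true  = s≤s z≤n

edgeCount-delete : ∀ {n} (G : OGraph n) D →
  edgeCount G ≤ edgeCount (delete G D) + ∑[ i < n ] ∑[ j < n ] ind (D i j)
edgeCount-delete {n} G D = begin
  edgeCount G
    ≡⟨ edgeCount-∑ G ⟩
  ∑[ i < n ] ∑[ j < n ] ind (lt i j ∧ G i j)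
    ≤⟨ ∑-mono n (λ i → ∑-mono n (λ j → ind-delete (lt i j) (G i j) (D i j))) ⟩
  ∑[ i < n ] ∑[ j < n ] (ind (lt i j ∧ delete G D i j) + ind (D i j))
    ≡⟨ trans (sum-cong-≗ {n} (λ i → ∑-distrib-+ {n} _ _)) (∑-distrib-+ {n} _ _) ⟩
  ∑[ i < n ] ∑[ j < n ] ind (lt i j ∧ delete G D i j) + ∑[ i < n ] ∑[ j < n ] ind (D i j)
    ≡⟨ cong (_+ _) (sym (edgeCount-∑ (delete G D))) ⟩
  edgeCount (delete G D) + ∑[ i < n ] ∑[ j < n ] ind (D i j) ∎
  where
  open ≤-Reasoning
  lt : Fin n → Fin n → Bool
  lt i j = toℕ i <ᵇ toℕ j

longestRight : ∀ {n} → OGraph n → Fin n → Fin n → Bool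
longestRight G x y = (toℕ x <ᵇ toℕ y) ∧ G x y ∧ not (anyFin (λ y′ → (toℕ y <ᵇ toℕ y′) ∧ G x y′))

longestLeft : ∀ {n} → OGraph n → Fin n → Fin n → Bool
longestLeft G x y = (toℕ x <ᵇ toℕ y) ∧ G x y ∧ not (anyFin (λ x′ → (toℕ x′ <ᵇ toℕ x) ∧ G x′ y))

longestRight-maximal : ∀ {n} (G : OGraph n) {x y y′} → longestRight G x y ≡ true →
  toℕ y < toℕ y′ → G x y′ ≡ true → ⊥
longestRight-maximal G {x} {y} {y′} h y<y′ e = true≢false
  (anyFin-complete _ y′ (∧-intro (<⇒<ᵇ′ y<y′) e))
  (not-true (∧-elimʳ {G x y} (∧-elimʳ {toℕ x <ᵇ toℕ y} h)))

longestLeft-maximal : ∀ {n} (G : OGraph n) {x x′ y} → longestLeft G x y ≡ true →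
  toℕ x′ < toℕ x → G x′ y ≡ true → ⊥
longestLeft-maximal G {x} {x′} {y} h x′<x e = true≢false
  (anyFin-complete _ x′ (∧-intro (<⇒<ᵇ′ x′<x) e))
  (not-true (∧-elimʳ {G x y} (∧-elimʳ {toℕ x <ᵇ toℕ y} h)))

longestRight-unique : ∀ {n} (G : OGraph n) x y₁ y₂ →
  longestRight G x y₁ ≡ true → longestRight G x y₂ ≡ true → y₁ ≡ y₂
longestRight-unique G x y₁ y₂ h₁ h₂ with <-cmp (toℕ y₁) (toℕ y₂)
... | tri≈ _ e _ = toℕ-injective e
... | tri< y₁<y₂ _ _ = ⊥-elim (longestRight-maximal G h₁ y₁<y₂ (∧-elimˡ (∧-elimʳ {toℕ x <ᵇ toℕ y₂} h₂)))
... | tri> _ _ y₂<y₁ = ⊥-elim (longestRight-maximal G h₂ y₂<y₁ (∧-elimˡ (∧-elimʳ {toℕ x <ᵇ toℕ y₁} h₁)))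

longestLeft-unique : ∀ {n} (G : OGraph n) y x₁ x₂ →
  longestLeft G x₁ y ≡ true → longestLeft G x₂ y ≡ true → x₁ ≡ x₂
longestLeft-unique G y x₁ x₂ h₁ h₂ with <-cmp (toℕ x₁) (toℕ x₂)
... | tri≈ _ e _ = toℕ-injective e
... | tri< x₁<x₂ _ _ = ⊥-elim (longestLeft-maximal G h₂ x₁<x₂ (∧-elimˡ (∧-elimʳ {toℕ x₁ <ᵇ toℕ y} h₁)))
... | tri> _ _ x₂<x₁ = ⊥-elim (longestLeft-maximal G h₁ x₂<x₁ (∧-elimˡ (∧-elimʳ {toℕ x₂ <ᵇ toℕ y} h₂)))

dropRight : ∀ {n} → ℕ → ℕ → OGraph n → Fin n → Fin n → Bool
dropRight lo hi G x y = inWindow lo hi (toℕ x) ∧ longestRight G x y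

dropLeft : ∀ {n} → ℕ → ℕ → OGraph n → Fin n → Fin n → Bool
dropLeft lo hi G x y = inWindow lo hi (toℕ y) ∧ longestLeft G x y

row-atMostOne : ∀ {n} (a : Bool) (Q : Fin n → Bool) → (∀ i j → Q i ≡ true → Q j ≡ true → i ≡ j) →
  ∑[ j < n ] ind (a ∧ Q j) ≤ ind a
row-atMostOne {n} false Q _    = ≤-reflexive (∑-zero n (λ _ → refl))
row-atMostOne {n} true  Q uniq = ∑-ind-atMostOne n Q uniq

dropRight-count : ∀ {n} lo hi (G : OGraph n) →
  ∑[ i < n ] ∑[ j < n ] ind (dropRight lo hi G i j) ≤ hi ∸ lo
dropRight-count {n} lo hi G = ≤-trans
  (∑-mono n (λ i → row-atMostOne (inWindow lo hi (toℕ i)) (longestRight G i) (longestRight-unique G i)))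
  (count-window n lo hi)

dropLeft-count : ∀ {n} lo hi (G : OGraph n) →
  ∑[ i < n ] ∑[ j < n ] ind (dropLeft lo hi G i j) ≤ hi ∸ lo
dropLeft-count {n} lo hi G = begin
  ∑[ i < n ] ∑[ j < n ] ind (dropLeft lo hi G i j) ≡⟨ ∑-comm {n} {n} _ ⟩
  ∑[ j < n ] ∑[ i < n ] ind (dropLeft lo hi G i j)
    ≤⟨ ∑-mono n (λ j → row-atMostOne (inWindow lo hi (toℕ j)) (λ i → longestLeft G i j) (longestLeft-unique G j)) ⟩
  sumBelow n (λ j → ind (inWindow lo hi j)) ≤⟨ count-window n lo hi ⟩
  hi ∸ lo ∎
  where open ≤-Reasoning

undropped : ∀ {a b c d} → a ≡ true → b ≡ true → c ≡ true → a ∧ (b ∧ (c ∧ not d)) ≡ false → d ≡ true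
undropped {d = true}  _    _    _    _  = refl
undropped {d = false} refl refl refl ()

dropRight-survivor : ∀ {n} lo hi (G : OGraph n) x y → inWindow lo hi (toℕ x) ≡ true →
  delete G (dropRight lo hi G) x y ≡ true → toℕ x < toℕ y →
  Σ (Fin n) λ y′ → toℕ y < toℕ y′ × G x y′ ≡ true
dropRight-survivor {n} lo hi G x y inW kept x<y = fromBool (anyFin-sound _ notLongest)
  where
  notLongest : anyFin (λ y′ → (toℕ y <ᵇ toℕ y′) ∧ G x y′) ≡ true
  notLongest = undropped inW (<⇒<ᵇ′ x<y) (∧-elimˡ kept) (not-true (∧-elimʳ {G x y} kept))
  fromBool : Σ (Fin n) (λ y′ → (toℕ y <ᵇ toℕ y′) ∧ G x y′ ≡ true) →
    Σ (Fin n) λ y′ → toℕ y < toℕ y′ × G x y′ ≡ true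
  fromBool (y′ , e) = y′ , <ᵇ⇒<′ (∧-elimˡ e) , ∧-elimʳ e

dropLeft-survivor : ∀ {n} lo hi (G : OGraph n) x y → inWindow lo hi (toℕ y) ≡ true →
  delete G (dropLeft lo hi G) x y ≡ true → toℕ x < toℕ y →
  Σ (Fin n) λ x′ → toℕ x′ < toℕ x × G x′ y ≡ true
dropLeft-survivor {n} lo hi G x y inW kept x<y = fromBool (anyFin-sound _ notLongest)
  where
  notLongest : anyFin (λ x′ → (toℕ x′ <ᵇ toℕ x) ∧ G x′ y) ≡ true
  notLongest = undropped inW (<⇒<ᵇ′ x<y) (∧-elimˡ kept) (not-true (∧-elimʳ {G x y} kept))
  fromBool : Σ (Fin n) (λ x′ → (toℕ x′ <ᵇ toℕ x) ∧ G x′ y ≡ true) →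
    Σ (Fin n) λ x′ → toℕ x′ < toℕ x × G x′ y ≡ true
  fromBool (x′ , e) = x′ , <ᵇ⇒<′ (∧-elimˡ e) , ∧-elimʳ e

exValue : ℕ → ℕ → ℕ
exValue k n = (k ∸ 1) * n ∸ k C 2

suc-C2 : ∀ m → suc m C 2 ≡ m + m C 2
suc-C2 m = trans (sym (nCk+nC[k+1]≡[n+1]C[k+1] m 1)) (cong (_+ m C 2) (nC1≡n m))

-- C(t + 1, 2) ≤ t², so the subtractions in exValue do not truncate.
C2≤square : ∀ t → suc t C 2 ≤ t * t
C2≤square zero    = z≤n
C2≤square (suc t) = begin
  suc (suc t) C 2    ≡⟨ suc-C2 (suc t) ⟩
  suc t + suc t C 2  ≤⟨ +-monoʳ-≤ (suc t) (C2≤square t) ⟩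
  suc t + t * t      ≤⟨ +-monoʳ-≤ (suc t) (*-monoʳ-≤ t (n≤1+n t)) ⟩
  suc t + t * suc t  ∎
  where open ≤-Reasoning

∸-+-distrib : ∀ {a c m d} → c ≤ a → d ≤ m → (a ∸ c) + (m ∸ d) ≡ (a + m) ∸ (c + d)
∸-+-distrib {a} {c} {m} {d} c≤a d≤m = sym (begin
  (a + m) ∸ (c + d)                       ≡⟨ cong (_∸ (c + d)) (cong₂ _+_ (m∸n+n≡m c≤a) (m∸n+n≡m d≤m)) ⟨
  ((a ∸ c) + c) + ((m ∸ d) + d) ∸ (c + d) ≡⟨ cong (_∸ (c + d)) (+-interchange (a ∸ c) c (m ∸ d) d) ⟩
  ((a ∸ c) + (m ∸ d)) + (c + d) ∸ (c + d) ≡⟨ m+n∸n≡m _ (c + d) ⟩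
  (a ∸ c) + (m ∸ d)                       ∎)
  where open ≡-Reasoning

-- One more vertex of the tree adds n - ℓ to the extremal value:
-- this is the recursion the deletion argument produces.
exValue-step : ∀ ℓ n → 1 ≤ ℓ → ℓ ≤ n → exValue ℓ n + (n ∸ ℓ) ≡ exValue (suc ℓ) n
exValue-step (suc t) n _ 1+t≤n = begin
  (t * n ∸ suc t C 2) + (n ∸ suc t) ≡⟨ ∸-+-distrib C≤tn 1+t≤n ⟩
  (t * n + n) ∸ (suc t C 2 + suc t) ≡⟨ cong₂ _∸_ (+-comm (t * n) n) (+-comm (suc t C 2) (suc t)) ⟩
  (n + t * n) ∸ (suc t + suc t C 2) ≡⟨ cong ((n + t * n) ∸_) (suc-C2 (suc t)) ⟨
  suc t * n ∸ suc (suc t) C 2 ∎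
  where
  open ≡-Reasoning
  C≤tn : suc t C 2 ≤ t * n
  C≤tn = ≤-trans (C2≤square t) (*-monoʳ-≤ t (≤-trans (n≤1+n t) 1+t≤n))

-- The upper bound

ExBound : ℕ → Pattern → Set
ExBound N P = ∀ n → N ≤ n → (G : OGraph n) → ¬ Embeds N P G → edgeCount G ≤ exValue (N ∸ 1) n

prepend : ∀ {n} → Fin n → (ℕ → Fin n) → ℕ → Fin n
prepend x ψ zero    = x
prepend x ψ (suc u) = ψ u

append : ∀ {n} → (ℕ → Fin n) → ℕ → Fin n → ℕ → Fin n
append ψ N y u = if u <ᵇ N then ψ u else y

append-old : ∀ {n} (ψ : ℕ → Fin n) {N} y {u} → u < N → append ψ N y u ≡ ψ u
append-old ψ y u<N rewrite <⇒<ᵇ′ u<N = refl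

append-new : ∀ {n} (ψ : ℕ → Fin n) N y → append ψ N y N ≡ y
append-new ψ N y rewrite ≮⇒<ᵇ-false (n≮n N) = refl

-- Any edge is a copy of a two-vertex pattern, so avoiding one forbids all edges.
exBound-edge : ∀ P → ExBound 2 P
exBound-edge P n _ G noCopy =
  ≤-reflexive (trans (edgeCount-∑ G) (∑-zero n (λ i → ∑-zero n (λ j → noEdge i j))))
  where
  noEdge : ∀ i j → ind ((toℕ i <ᵇ toℕ j) ∧ G i j) ≡ 0
  noEdge i j with toℕ i <ᵇ toℕ j in i<j | G i j in ij
  ... | false | _     = refl
  ... | true  | false = refl
  ... | true  | true  = ⊥-elim (noCopy (prepend i (λ _ → j) , incr , edges))
    where
    incr : IncreasingOn 2 (prepend i (λ _ → j))
    incr zero    (suc zero)     _        _               = <ᵇ⇒<′ i<j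
    incr (suc u) (suc zero)     (s≤s ()) _
    incr _       (suc (suc w))  _        (s≤s (s≤s ()))
    edges : ∀ u w → u < w → w < 2 → P u w ≡ true → G (prepend i (λ _ → j) u) (prepend i (λ _ → j) w) ≡ true
    edges zero    (suc zero)    _        _              _ = ij
    edges (suc u) (suc zero)    (s≤s ()) _              _
    edges _       (suc (suc w)) _        (s≤s (s≤s ())) _

-- The image of v under a copy of a pattern on ℓ + 1 vertices lies in
-- the window v ≤ x < n - (ℓ - v): at least v vertices precede it and
-- at least ℓ - v follow it.
window-member : ∀ {n ℓ v} {ψ : ℕ → Fin n} → IncreasingOn (suc ℓ) ψ → v ≤ ℓ →
  inWindow v (n ∸ (ℓ ∸ v)) (toℕ (ψ v)) ≡ true
window-member {n} {ℓ} {v} {ψ} incr v≤ℓ =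
  ∧-intro (cong not (≮⇒<ᵇ-false (≤⇒≯ (increasing-≥ incr v (s≤s v≤ℓ))))) (<⇒<ᵇ′ belowTop)
  where
  gap : toℕ (ψ v) + (ℓ ∸ v) ≤ toℕ (ψ (v + (ℓ ∸ v)))
  gap = increasing-gap incr (ℓ ∸ v) v (subst (_< suc ℓ) (sym (m+[n∸m]≡n v≤ℓ)) (n<1+n ℓ))
  belowTop : toℕ (ψ v) < n ∸ (ℓ ∸ v)
  belowTop = m+n≤o⇒m≤o∸n (suc (toℕ (ψ v))) (≤-trans (s≤s gap) (toℕ<n (ψ (v + (ℓ ∸ v)))))

window-size : ∀ n ℓ v → v ≤ ℓ → n ∸ (ℓ ∸ v) ∸ v ≡ n ∸ ℓ
window-size n ℓ v v≤ℓ =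
  trans (∸-+-assoc n (ℓ ∸ v) v) (cong (n ∸_) (trans (+-comm (ℓ ∸ v) v) (m+[n∸m]≡n v≤ℓ)))

rightExtension-complete : ∀ {ℓ P′ P v n} {G H : OGraph n} {ψ : ℕ → Fin n} →
  RightExtension (suc ℓ) P′ P v → (∀ x y → H x y ≡ true → G x y ≡ true) →
  IsCopy (suc ℓ) P′ H ψ → ∀ y′ → toℕ (ψ ℓ) < toℕ y′ → G (ψ v) y′ ≡ true →
  IsCopy (suc (suc ℓ)) P G (append ψ (suc ℓ) y′)
rightExtension-complete {ℓ} {P = P} {n = n} {G = G} {ψ = ψ} ext H⊆G (incr , edges) y′ ψℓ<y′ Gvy′ =
  incr′ , edges′
  where
  open RightExtension ext
  ψ′ : ℕ → Fin n
  ψ′ = append ψ (suc ℓ) y′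
  incr′ : IncreasingOn (suc (suc ℓ)) ψ′
  incr′ u w u<w w<2+ℓ with m<1+n⇒m<n∨m≡n w<2+ℓ
  ... | inj₁ w<1+ℓ = subst₂ (λ a b → toℕ a < toℕ b) (sym (append-old ψ y′ (<-trans u<w w<1+ℓ)))
                       (sym (append-old ψ y′ w<1+ℓ)) (incr u w u<w w<1+ℓ)
  ... | inj₂ refl  = subst₂ (λ a b → toℕ a < toℕ b) (sym (append-old ψ y′ u<w)) (sym (append-new ψ (suc ℓ) y′))
                       (≤-<-trans (increasing-≤ incr u ℓ (≤-pred u<w) (n<1+n ℓ)) ψℓ<y′)
  edges′ : ∀ u w → u < w → w < suc (suc ℓ) → P u w ≡ true → G (ψ′ u) (ψ′ w) ≡ true
  edges′ u w u<w w<2+ℓ Puw with m<1+n⇒m<n∨m≡n w<2+ℓ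
  ... | inj₁ w<1+ℓ = subst₂ (λ a b → G a b ≡ true) (sym (append-old ψ y′ (<-trans u<w w<1+ℓ)))
                       (sym (append-old ψ y′ w<1+ℓ))
                       (H⊆G _ _ (edges u w u<w w<1+ℓ (trans (sym (old u w w<1+ℓ)) Puw)))
  ... | inj₂ refl with refl ← newOnly u u<w Puw =
    subst₂ (λ a b → G a b ≡ true) (sym (append-old ψ y′ u<w)) (sym (append-new ψ (suc ℓ) y′)) Gvy′

leftExtension-complete : ∀ {ℓ P′ P v n} {G H : OGraph n} {ψ : ℕ → Fin n} →
  LeftExtension (suc ℓ) P′ P v → (∀ x y → H x y ≡ true → G x y ≡ true) →
  IsCopy (suc ℓ) P′ H ψ → ∀ x′ → toℕ x′ < toℕ (ψ 0) → G x′ (ψ v) ≡ true →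
  IsCopy (suc (suc ℓ)) P G (prepend x′ ψ)
leftExtension-complete {ℓ} {P = P} {G = G} {ψ = ψ} ext H⊆G (incr , edges) x′ x′<ψ0 Gx′v =
  incr′ , edges′
  where
  open LeftExtension ext
  incr′ : IncreasingOn (suc (suc ℓ)) (prepend x′ ψ)
  incr′ zero    (suc w) _   w<2+ℓ = <-≤-trans x′<ψ0 (increasing-≤ incr 0 w z≤n (≤-pred w<2+ℓ))
  incr′ (suc u) (suc w) u<w w<2+ℓ = incr u w (≤-pred u<w) (≤-pred w<2+ℓ)
  edges′ : ∀ u w → u < w → w < suc (suc ℓ) → P u w ≡ true → G (prepend x′ ψ u) (prepend x′ ψ w) ≡ true
  edges′ zero    (suc w) _   w<2+ℓ Puw with refl ← newOnly w (≤-pred w<2+ℓ) Puw = Gx′v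
  edges′ (suc u) (suc w) u<w w<2+ℓ Puw =
    H⊆G _ _ (edges u w (≤-pred u<w) (≤-pred w<2+ℓ) (trans (sym (old u w)) Puw))

rightExtension-exBound : ∀ {N′ P′ P v} → RightExtension N′ P′ P v → ExBound N′ P′ → ExBound (suc N′) P
rightExtension-exBound {zero} ext _ = ⊥-elim (n≮0 (RightExtension.1+v<N′ ext))
rightExtension-exBound {suc ℓ} {P′} {v = v} ext bound n 2+ℓ≤n G noCopy = begin
  edgeCount G                         ≤⟨ edgeCount-delete G (dropRight v top G) ⟩
  edgeCount G′ + ∑[ i < n ] ∑[ j < n ] ind (dropRight v top G i j)
    ≤⟨ +-mono-≤ (bound n (≤-trans (n≤1+n (suc ℓ)) 2+ℓ≤n) G′ noCopy′) (dropRight-count v top G) ⟩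
  exValue ℓ n + (top ∸ v)             ≡⟨ cong (exValue ℓ n +_) (window-size n ℓ v v≤ℓ) ⟩
  exValue ℓ n + (n ∸ ℓ)               ≡⟨ exValue-step ℓ n (≤-trans (s≤s z≤n) v<ℓ) (≤-trans (m≤n+m ℓ 2) 2+ℓ≤n) ⟩
  exValue (suc ℓ) n                   ∎
  where
  open ≤-Reasoning
  open RightExtension ext
  v<ℓ : v < ℓ
  v<ℓ = ≤-pred 1+v<N′
  v≤ℓ : v ≤ ℓ
  v≤ℓ = <⇒≤ v<ℓ
  top : ℕ
  top = n ∸ (ℓ ∸ v)
  G′ : OGraph n
  G′ = delete G (dropRight v top G)
  noCopy′ : ¬ Embeds (suc ℓ) P′ G′
  noCopy′ (ψ , copy@(incr , edges))
    with y′ , ψℓ<y′ , Gvy′ ← dropRight-survivor v top G (ψ v) (ψ ℓ) (window-member incr v≤ℓ)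
                               (edges v ℓ v<ℓ (n<1+n ℓ) anchor) (incr v ℓ v<ℓ (n<1+n ℓ))
    = noCopy (_ , rightExtension-complete ext (delete-⊆ G (dropRight v top G)) copy y′ ψℓ<y′ Gvy′)

leftExtension-exBound : ∀ {N′ P′ P v} → LeftExtension N′ P′ P v → ExBound N′ P′ → ExBound (suc N′) P
leftExtension-exBound {zero} ext _ = ⊥-elim (n≮0 (LeftExtension.v<N′ ext))
leftExtension-exBound {suc ℓ} {P′} {v = v} ext bound n 2+ℓ≤n G noCopy = begin
  edgeCount G                         ≤⟨ edgeCount-delete G (dropLeft v top G) ⟩
  edgeCount G′ + ∑[ i < n ] ∑[ j < n ] ind (dropLeft v top G i j)
    ≤⟨ +-mono-≤ (bound n (≤-trans (n≤1+n (suc ℓ)) 2+ℓ≤n) G′ noCopy′) (dropLeft-count v top G) ⟩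
  exValue ℓ n + (top ∸ v)             ≡⟨ cong (exValue ℓ n +_) (window-size n ℓ v v≤ℓ) ⟩
  exValue ℓ n + (n ∸ ℓ)               ≡⟨ exValue-step ℓ n (≤-trans 0<v v≤ℓ) (≤-trans (m≤n+m ℓ 2) 2+ℓ≤n) ⟩
  exValue (suc ℓ) n                   ∎
  where
  open ≤-Reasoning
  open LeftExtension ext
  v≤ℓ : v ≤ ℓ
  v≤ℓ = ≤-pred v<N′
  top : ℕ
  top = n ∸ (ℓ ∸ v)
  G′ : OGraph n
  G′ = delete G (dropLeft v top G)
  noCopy′ : ¬ Embeds (suc ℓ) P′ G′
  noCopy′ (ψ , copy@(incr , edges))
    with x′ , x′<ψ0 , Gx′v ← dropLeft-survivor v top G (ψ 0) (ψ v) (window-member incr v≤ℓ)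
                               (edges 0 v 0<v v<N′ anchor) (incr 0 v 0<v v<N′)
    = noCopy (_ , leftExtension-complete ext (delete-⊆ G (dropLeft v top G)) copy x′ x′<ψ0 Gx′v)

-- The lower bound

frame : ℕ → ℕ → ℕ → Pattern
frame p q n x y = (x <ᵇ p) ∨ not (y <ᵇ n ∸ q)

C2-double : ∀ q → q C 2 + suc q C 2 ≡ q * q
C2-double zero    = refl
C2-double (suc q) = begin
  suc q C 2 + suc (suc q) C 2       ≡⟨ cong₂ _+_ (suc-C2 q) (suc-C2 (suc q)) ⟩
  (q + c) + (suc q + suc q C 2)     ≡⟨ cong (λ x → (q + c) + (suc q + x)) (suc-C2 q) ⟩
  (q + c) + (suc q + (q + c))       ≡⟨ solve 2 (λ q c → (q :+ c) :+ ((con 1 :+ q) :+ (q :+ c)) :=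
                                                        (c :+ (q :+ c)) :+ (con 1 :+ q :+ q)) refl q c ⟩
  (c + (q + c)) + (suc q + q)       ≡⟨ cong (λ x → (c + x) + (suc q + q)) (suc-C2 q) ⟨
  (c + suc q C 2) + (suc q + q)     ≡⟨ cong (_+ (suc q + q)) (C2-double q) ⟩
  q * q + (suc q + q)               ≡⟨ solve 1 (λ q → q :* q :+ (con 1 :+ q :+ q) := (con 1 :+ q) :* (con 1 :+ q)) refl q ⟩
  suc q * suc q                     ∎
  where
  open ≡-Reasoning
  open +-*-Solver
  c : ℕ
  c = q C 2

frame₀-peel : ∀ q n → q ≤ n → pairCount (suc n) (frame 0 q (suc n)) ≡ q + pairCount n (frame 0 q n)
frame₀-peel q n q≤n rewrite +-∸-assoc 1 q≤n =
  cong (_+ pairCount n (frame 0 q n)) (trans (count-atLeast n (n ∸ q)) (m∸[m∸n]≡n q≤n))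

frame-peel : ∀ p q n → q ≤ n → pairCount (suc n) (frame (suc p) q (suc n)) ≡ n + pairCount n (frame p q n)
frame-peel p q n q≤n rewrite +-∸-assoc 1 q≤n = cong (_+ pairCount n (frame p q n)) (sumBelow-ones n)

frame₀-count : ∀ q r → pairCount (q + r) (frame 0 q (q + r)) + suc q C 2 ≡ q * (q + r)
frame₀-count q zero rewrite +-identityʳ q | n∸n≡0 q =
  trans (cong (_+ suc q C 2) (pairCount-complete q)) (C2-double q)
frame₀-count q (suc r) rewrite +-suc q r = begin
  pairCount (suc (q + r)) (frame 0 q (suc (q + r))) + suc q C 2
    ≡⟨ cong (_+ suc q C 2) (frame₀-peel q (q + r) (m≤m+n q r)) ⟩
  q + pairCount (q + r) (frame 0 q (q + r)) + suc q C 2   ≡⟨ +-assoc q _ _ ⟩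
  q + (pairCount (q + r) (frame 0 q (q + r)) + suc q C 2) ≡⟨ cong (q +_) (frame₀-count q r) ⟩
  q + q * (q + r)                                         ≡⟨ *-suc q (q + r) ⟨
  q * suc (q + r)                                         ∎
  where open ≡-Reasoning

-- The edge count of the frame in subtraction-free form, peeling off the
-- first vertex p times.
frame-count : ∀ p q n → p + q ≤ n → pairCount n (frame p q n) + suc (p + q) C 2 ≡ (p + q) * n
frame-count zero q n q≤n =
  subst (λ n → pairCount n (frame 0 q n) + suc q C 2 ≡ q * n) (m+[n∸m]≡n q≤n) (frame₀-count q (n ∸ q))
frame-count (suc p) q (suc n) (s≤s p+q≤n) = begin
  pairCount (suc n) (frame (suc p) q (suc n)) + suc (suc s) C 2
    ≡⟨ cong₂ _+_ (frame-peel p q n (≤-trans (m≤n+m q p) p+q≤n)) (suc-C2 (suc s)) ⟩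
  n + E + (suc s + c)   ≡⟨ solve 4 (λ n E s c → n :+ E :+ (con 1 :+ s :+ c) := (n :+ con 1 :+ s) :+ (E :+ c)) refl n E s c ⟩
  (n + 1 + s) + (E + c) ≡⟨ cong ((n + 1 + s) +_) (frame-count p q n p+q≤n) ⟩
  (n + 1 + s) + s * n   ≡⟨ solve 2 (λ n s → (n :+ con 1 :+ s) :+ s :* n := (con 1 :+ s) :* (con 1 :+ n)) refl n s ⟩
  suc s * suc n         ∎
  where
  open ≡-Reasoning
  open +-*-Solver
  s : ℕ
  s = p + q
  E : ℕ
  E = pairCount n (frame p q n)
  c : ℕ
  c = suc s C 2

frame-edgeCount : ∀ p q n → p + q ≤ n → edgeCount (restrict n (frame p q n)) ≡ exValue (suc (p + q)) n
frame-edgeCount p q n p+q≤n = begin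
  edgeCount (restrict n (frame p q n))                        ≡⟨ edgeCount-restrict n (frame p q n) ⟩
  pairCount n (frame p q n)                                   ≡⟨ m+n∸n≡m _ (suc (p + q) C 2) ⟨
  pairCount n (frame p q n) + suc (p + q) C 2 ∸ suc (p + q) C 2 ≡⟨ cong (_∸ suc (p + q) C 2) (frame-count p q n p+q≤n) ⟩
  exValue (suc (p + q)) n                                     ∎
  where open ≡-Reasoning

-- A pattern on p + q + 2 vertices with an edge between the consecutive
-- vertices p and p + 1 has no copy in the frame: that edge would have
-- to start at or after position p and end before the last q positions.
frame-avoids : ∀ p q n P → P p (suc p) ≡ true → ¬ Embeds (suc (suc (p + q))) P (restrict n (frame p q n))
frame-avoids p q n P Pp (ψ , incr , edges) = true≢false
  (edges p (suc p) (n<1+n p) (s≤s (s≤s (m≤m+n p q))) Pp)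
  (cong₂ _∨_ (≮⇒<ᵇ-false (≤⇒≯ atLeastP)) (cong not (<⇒<ᵇ′ beforeLastQ)))
  where
  atLeastP : p ≤ toℕ (ψ p)
  atLeastP = increasing-≥ incr p (s≤s (≤-trans (m≤m+n p q) (n≤1+n _)))
  gap : toℕ (ψ (suc p)) + q ≤ toℕ (ψ (suc p + q))
  gap = increasing-gap incr q (suc p) (n<1+n _)
  beforeLastQ : toℕ (ψ (suc p)) < n ∸ q
  beforeLastQ = m+n≤o⇒m≤o∸n (suc (toℕ (ψ (suc p)))) (≤-trans (s≤s gap) (toℕ<n (ψ (suc p + q))))

hasEdge⇒∈ : ∀ es u v → hasEdge es u v ≡ true → (u , v) ∈ es
hasEdge⇒∈ ((x , y) ∷ es) u v h with x ≡ᵇ u in x≡u | y ≡ᵇ v in y≡v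
... | true  | true  = here (cong₂ _,_ (sym (≡ᵇ⇒≡ x u (Equivalence.from T-≡ x≡u)))
                                     (sym (≡ᵇ⇒≡ y v (Equivalence.from T-≡ y≡v))))
... | true  | false = there (hasEdge⇒∈ es u v h)
... | false | _     = there (hasEdge⇒∈ es u v h)

∈⇒hasEdge : ∀ es u v → (u , v) ∈ es → hasEdge es u v ≡ true
∈⇒hasEdge ((x , y) ∷ es) u v (here refl)
  rewrite Equivalence.to T-≡ (≡⇒≡ᵇ u u refl) | Equivalence.to T-≡ (≡⇒≡ᵇ v v refl) = refl
∈⇒hasEdge ((x , y) ∷ es) u v (there p) = ∨-introʳ _ (∈⇒hasEdge es u v p)

shiftPair : ℕ → ℕ × ℕ → ℕ × ℕ
shiftPair c (u , v) = c + u , c + v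

shift-∈⁺ : ∀ c es {u v} → (u , v) ∈ es → (c + u , c + v) ∈ shift c es
shift-∈⁺ c es = ∈-map⁺ (shiftPair c)

shift-∈⁻ : ∀ c es {x y} → (x , y) ∈ shift c es →
  Σ ℕ λ u → Σ ℕ λ v → x ≡ c + u × y ≡ c + v × (u , v) ∈ es
shift-∈⁻ c es p with ∈-map⁻ (shiftPair c) p
... | (u , v) , uv∈es , refl = u , v , refl , refl , uv∈es

incEdges-longest : ∀ w → (0 , suc (length w)) ∈ incEdges w
incEdges-longest []         = here refl
incEdges-longest (addI ∷ w) = here refl
incEdges-longest (addJ ∷ w) = here refl

incEdges-bounds : ∀ w {u v} → (u , v) ∈ incEdges w → u < v × v < incSize w
incEdges-bounds []         (here refl) = s≤s z≤n , s≤s (s≤s z≤n)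
incEdges-bounds (addJ ∷ w) (here refl) = s≤s z≤n , n<1+n _
incEdges-bounds (addJ ∷ w) (there p)   = let (u<v , v<m) = incEdges-bounds w p in u<v , m<n⇒m<1+n v<m
incEdges-bounds (addI ∷ w) (here refl) = s≤s z≤n , n<1+n _
incEdges-bounds (addI ∷ w) (there p) with shift-∈⁻ 1 (incEdges w) p
... | u , v , refl , refl , q = let (u<v , v<m) = incEdges-bounds w q in s≤s u<v , s≤s v<m

-- The number of addI steps; the part I of the tree is 0 , … , leftSteps w.
leftSteps : List Step → ℕ
leftSteps []         = 0
leftSteps (addI ∷ w) = suc (leftSteps w)
leftSteps (addJ ∷ w) = leftSteps w

leftSteps≤length : ∀ w → leftSteps w ≤ length w
leftSteps≤length []         = z≤n
leftSteps≤length (addI ∷ w) = s≤s (leftSteps≤length w)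
leftSteps≤length (addJ ∷ w) = m≤n⇒m≤1+n (leftSteps≤length w)

incEdges-middle : ∀ w → (leftSteps w , suc (leftSteps w)) ∈ incEdges w
incEdges-middle []         = here refl
incEdges-middle (addJ ∷ w) = there (incEdges-middle w)
incEdges-middle (addI ∷ w) = there (shift-∈⁺ 1 (incEdges w) (incEdges-middle w))

-- z-trees as iterated extensions

data ZEdge (w : List Step) (a b u v : ℕ) : Set where
  treeEdge : ∀ u′ v′ → u ≡ a + u′ → v ≡ a + v′ → (u′ , v′) ∈ incEdges w → ZEdge w a b u v
  hEdge    : u < a → v ≡ a + incSize w ∸ 1 → ZEdge w a b u v
  kEdge    : u ≡ a → ∀ t → t < b → v ≡ a + incSize w + t → ZEdge w a b u v

zPattern : List Step → ℕ → ℕ → Pattern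
zPattern w a b = hasEdge (zEdges w a b)

zPattern⇒ZEdge : ∀ w a b {u v} → zPattern w a b u v ≡ true → ZEdge w a b u v
zPattern⇒ZEdge w a b {u} {v} h = classify (∈-++⁻ (shift a (incEdges w)) (hasEdge⇒∈ _ u v h))
  where
  hs : List (ℕ × ℕ)
  hs = map (λ h → (h , a + incSize w ∸ 1)) (upTo a)
  ks : List (ℕ × ℕ)
  ks = map (λ t → (a , a + incSize w + t)) (upTo b)
  classify : (u , v) ∈ shift a (incEdges w) ⊎ (u , v) ∈ hs ++ ks → ZEdge w a b u v
  classify (inj₁ p) = let (u′ , v′ , eu , ev , q) = shift-∈⁻ a (incEdges w) p in treeEdge u′ v′ eu ev q
  classify (inj₂ p) with ∈-++⁻ hs p
  ... | inj₁ q with h , h∈ , refl ← ∈-map⁻ (λ h → (h , a + incSize w ∸ 1)) q = hEdge (∈-upTo⁻ h∈) refl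
  ... | inj₂ q with t , t∈ , refl ← ∈-map⁻ (λ t → (a , a + incSize w + t)) q = kEdge refl t (∈-upTo⁻ t∈) refl

ZEdge⇒zPattern : ∀ w a b {u v} → ZEdge w a b u v → zPattern w a b u v ≡ true
ZEdge⇒zPattern w a b {u} {v} e = ∈⇒hasEdge _ u v (member e)
  where
  hs : List (ℕ × ℕ)
  hs = map (λ h → (h , a + incSize w ∸ 1)) (upTo a)
  member : ZEdge w a b u v → (u , v) ∈ zEdges w a b
  member (treeEdge u′ v′ refl refl q) = ∈-++⁺ˡ (shift-∈⁺ a (incEdges w) q)
  member (hEdge u<a refl) = ∈-++⁺ʳ (shift a (incEdges w))
    (∈-++⁺ˡ (∈-map⁺ (λ h → (h , a + incSize w ∸ 1)) (∈-upTo⁺ u<a)))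
  member (kEdge refl t t<b refl) = ∈-++⁺ʳ (shift a (incEdges w))
    (∈-++⁺ʳ hs (∈-map⁺ (λ t → (a , a + incSize w + t)) (∈-upTo⁺ t<b)))

lastTreeVertex : ∀ a w → a + incSize w ∸ 1 ≡ a + suc (length w)
lastTreeVertex a w = cong (_∸ 1) (+-suc a (suc (length w)))

tree⇒∈ : ∀ w {u v} → zPattern w 0 0 u v ≡ true → (u , v) ∈ incEdges w
tree⇒∈ w h with zPattern⇒ZEdge w 0 0 h
... | treeEdge u′ v′ refl refl q = q
... | hEdge () _
... | kEdge _ t () _

∈⇒tree : ∀ w {u v} → (u , v) ∈ incEdges w → zPattern w 0 0 u v ≡ true
∈⇒tree w q = ZEdge⇒zPattern w 0 0 (treeEdge _ _ refl refl q)

addK-extension : ∀ w a b → RightExtension (zSize w a b) (zPattern w a b) (zPattern w a (suc b)) a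
addK-extension w a b = record
  { old     = old
  ; newOnly = newOnly
  ; newEdge = ZEdge⇒zPattern w a (suc b) (kEdge refl b (n<1+n b) refl)
  ; 1+v<N′  = ≤-trans 2+a≤a+m a+m≤N
  ; anchor  = anchor b }
  where
  m : ℕ
  m = incSize w
  a+m≤N : a + m ≤ zSize w a b
  a+m≤N = m≤m+n (a + m) b
  2+a≤a+m : suc (suc a) ≤ a + m
  2+a≤a+m = subst (_≤ a + m) (+-comm a 2) (+-monoʳ-≤ a (m≤m+n 2 (length w)))
  old : ∀ i j → j < zSize w a b → zPattern w a (suc b) i j ≡ zPattern w a b i j
  old i j j<N = bool-ext shrink grow
    where
    shrink : zPattern w a (suc b) i j ≡ true → zPattern w a b i j ≡ true
    shrink h with zPattern⇒ZEdge w a (suc b) h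
    ... | treeEdge u′ v′ e₁ e₂ q = ZEdge⇒zPattern w a b (treeEdge u′ v′ e₁ e₂ q)
    ... | hEdge i<a e            = ZEdge⇒zPattern w a b (hEdge i<a e)
    ... | kEdge e t _ refl       = ZEdge⇒zPattern w a b (kEdge e t (+-cancelˡ-< (a + m) t b j<N) refl)
    grow : zPattern w a b i j ≡ true → zPattern w a (suc b) i j ≡ true
    grow h with zPattern⇒ZEdge w a b h
    ... | treeEdge u′ v′ e₁ e₂ q = ZEdge⇒zPattern w a (suc b) (treeEdge u′ v′ e₁ e₂ q)
    ... | hEdge i<a e            = ZEdge⇒zPattern w a (suc b) (hEdge i<a e)
    ... | kEdge e t t<b e′       = ZEdge⇒zPattern w a (suc b) (kEdge e t (m<n⇒m<1+n t<b) e′)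
  newOnly : ∀ i → i < zSize w a b → zPattern w a (suc b) i (zSize w a b) ≡ true → i ≡ a
  newOnly i _ h with zPattern⇒ZEdge w a (suc b) h
  ... | treeEdge u′ v′ _ e q = ⊥-elim (<-irrefl (sym e)
          (≤-trans (+-monoʳ-< a (proj₂ (incEdges-bounds w q))) a+m≤N))
  ... | hEdge _ e = ⊥-elim (<-irrefl (sym (trans e (lastTreeVertex a w)))
          (≤-trans (+-monoʳ-< a (n<1+n (suc (length w)))) a+m≤N))
  ... | kEdge e _ _ _ = e
  anchor : ∀ b → zPattern w a b a (zSize w a b ∸ 1) ≡ true
  anchor zero     = ZEdge⇒zPattern w a 0 (treeEdge 0 (suc (length w)) (sym (+-identityʳ a))
                      (trans (cong (_∸ 1) (+-identityʳ (a + m))) (lastTreeVertex a w)) (incEdges-longest w))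
  anchor (suc b′) = ZEdge⇒zPattern w a (suc b′) (kEdge refl b′ (n<1+n b′) (cong (_∸ 1) (+-suc (a + m) b′)))

addH-extension : ∀ w a → LeftExtension (zSize w a 0) (zPattern w a 0) (zPattern w (suc a) 0) (a + suc (length w))
addH-extension w a = record
  { old     = old
  ; newOnly = newOnly
  ; newEdge = ZEdge⇒zPattern w (suc a) 0 (hEdge (s≤s z≤n) (sym (lastTreeVertex (suc a) w)))
  ; v<N′    = subst (a + suc (length w) <_) (sym (+-identityʳ (a + incSize w))) (+-monoʳ-< a (n<1+n _))
  ; 0<v     = subst (0 <_) (sym (+-suc a (length w))) (s≤s z≤n)
  ; anchor  = anchor a }
  where
  old : ∀ i j → zPattern w (suc a) 0 (suc i) (suc j) ≡ zPattern w a 0 i j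
  old i j = bool-ext shrink grow
    where
    shrink : zPattern w (suc a) 0 (suc i) (suc j) ≡ true → zPattern w a 0 i j ≡ true
    shrink h with zPattern⇒ZEdge w (suc a) 0 h
    ... | treeEdge u′ v′ e₁ e₂ q = ZEdge⇒zPattern w a 0 (treeEdge u′ v′ (suc-injective e₁) (suc-injective e₂) q)
    ... | hEdge (s≤s i<a) e      = ZEdge⇒zPattern w a 0 (hEdge i<a
            (trans (suc-injective (trans e (lastTreeVertex (suc a) w))) (sym (lastTreeVertex a w))))
    ... | kEdge _ t () _
    grow : zPattern w a 0 i j ≡ true → zPattern w (suc a) 0 (suc i) (suc j) ≡ true
    grow h with zPattern⇒ZEdge w a 0 h
    ... | treeEdge u′ v′ e₁ e₂ q = ZEdge⇒zPattern w (suc a) 0 (treeEdge u′ v′ (cong suc e₁) (cong suc e₂) q)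
    ... | hEdge i<a e            = ZEdge⇒zPattern w (suc a) 0 (hEdge (s≤s i<a)
            (trans (cong suc (trans e (lastTreeVertex a w))) (sym (lastTreeVertex (suc a) w))))
    ... | kEdge _ t () _
  newOnly : ∀ j → j < zSize w a 0 → zPattern w (suc a) 0 0 (suc j) ≡ true → j ≡ a + suc (length w)
  newOnly j _ h with zPattern⇒ZEdge w (suc a) 0 h
  ... | treeEdge _ _ () _ _
  ... | hEdge _ e = suc-injective (trans e (lastTreeVertex (suc a) w))
  ... | kEdge () _ _ _
  anchor : ∀ a → zPattern w a 0 0 (a + suc (length w)) ≡ true
  anchor zero     = ∈⇒tree w (incEdges-longest w)
  anchor (suc a′) = ZEdge⇒zPattern w (suc a′) 0 (hEdge (s≤s z≤n) (sym (lastTreeVertex (suc a′) w)))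

addJ-extension : ∀ w → RightExtension (zSize w 0 0) (zPattern w 0 0) (zPattern (addJ ∷ w) 0 0) 0
addJ-extension w = record
  { old     = old
  ; newOnly = newOnly
  ; newEdge = ∈⇒tree (addJ ∷ w) (here (cong (0 ,_) size))
  ; 1+v<N′  = s≤s (s≤s z≤n)
  ; anchor  = ∈⇒tree w (subst (λ x → (0 , x) ∈ incEdges w) (cong suc (sym (+-identityʳ (length w))))
                          (incEdges-longest w)) }
  where
  size : zSize w 0 0 ≡ incSize w
  size = +-identityʳ (incSize w)
  old : ∀ i j → j < zSize w 0 0 → zPattern (addJ ∷ w) 0 0 i j ≡ zPattern w 0 0 i j
  old i j j<N = bool-ext shrink (λ h → ∈⇒tree (addJ ∷ w) (there (tree⇒∈ w h)))
    where
    shrink : zPattern (addJ ∷ w) 0 0 i j ≡ true → zPattern w 0 0 i j ≡ true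
    shrink h with tree⇒∈ (addJ ∷ w) h
    ... | here e  = ⊥-elim (<-irrefl (cong proj₂ e) (subst (j <_) size j<N))
    ... | there q = ∈⇒tree w q
  newOnly : ∀ i → i < zSize w 0 0 → zPattern (addJ ∷ w) 0 0 i (zSize w 0 0) ≡ true → i ≡ 0
  newOnly i _ h with tree⇒∈ (addJ ∷ w) h
  ... | here e  = cong proj₁ e
  ... | there q = ⊥-elim (<-irrefl size (proj₂ (incEdges-bounds w q)))

addI-extension : ∀ w → LeftExtension (zSize w 0 0) (zPattern w 0 0) (zPattern (addI ∷ w) 0 0) (suc (length w))
addI-extension w = record
  { old     = old
  ; newOnly = newOnly
  ; newEdge = ∈⇒tree (addI ∷ w) (here refl)
  ; v<N′    = s≤s (s≤s (≤-reflexive (sym (+-identityʳ (length w)))))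
  ; 0<v     = s≤s z≤n
  ; anchor  = ∈⇒tree w (incEdges-longest w) }
  where
  old : ∀ i j → zPattern (addI ∷ w) 0 0 (suc i) (suc j) ≡ zPattern w 0 0 i j
  old i j = bool-ext shrink (λ h → ∈⇒tree (addI ∷ w) (there (shift-∈⁺ 1 (incEdges w) (tree⇒∈ w h))))
    where
    shrink : zPattern (addI ∷ w) 0 0 (suc i) (suc j) ≡ true → zPattern w 0 0 i j ≡ true
    shrink h with tree⇒∈ (addI ∷ w) h
    ... | here ()
    ... | there q with shift-∈⁻ 1 (incEdges w) {suc i} {suc j} q
    ...   | _ , _ , refl , refl , q′ = ∈⇒tree w q′
  newOnly : ∀ j → j < zSize w 0 0 → zPattern (addI ∷ w) 0 0 0 (suc j) ≡ true → j ≡ suc (length w)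
  newOnly j _ h with tree⇒∈ (addI ∷ w) h
  ... | here e  = suc-injective (cong proj₂ e)
  ... | there q with shift-∈⁻ 1 (incEdges w) {0} {suc j} q
  ...   | _ , _ , () , _ , _

zTree-induction : (Q : ℕ → Pattern → Set) → Q 2 (zPattern [] 0 0) →
  (∀ {N′ P′ P v} → LeftExtension N′ P′ P v → Q N′ P′ → Q (suc N′) P) →
  (∀ {N′ P′ P v} → RightExtension N′ P′ P v → Q N′ P′ → Q (suc N′) P) →
  ∀ w a b → Q (zSize w a b) (zPattern w a b)
zTree-induction Q edge left right = go
  where
  go : ∀ w a b → Q (zSize w a b) (zPattern w a b)
  go w          a       (suc b) = subst (λ N → Q N (zPattern w a (suc b))) (sym (+-suc (a + incSize w) b))
                                     (right (addK-extension w a b) (go w a b))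
  go w          (suc a) zero    = left (addH-extension w a) (go w a 0)
  go (addJ ∷ w) zero    zero    = right (addJ-extension w) (go w 0 0)
  go (addI ∷ w) zero    zero    = left (addI-extension w) (go w 0 0)
  go []         zero    zero    = edge

zTree-pairCount : ∀ w a b → pairCount (zSize w a b) (zPattern w a b) + 1 ≡ zSize w a b
zTree-pairCount = zTree-induction (λ N P → pairCount N P + 1 ≡ N) refl
  (λ ext ih → trans (cong (_+ 1) (trans (leftExtension-pairCount ext) ih)) (+-comm _ 1))
  (λ ext ih → trans (cong (_+ 1) (trans (rightExtension-pairCount ext) ih)) (+-comm _ 1))

zTree-exBound : ∀ w a b → ExBound (zSize w a b) (zPattern w a b)
zTree-exBound = zTree-induction ExBound (exBound-edge _) leftExtension-exBound rightExtension-exBound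

-- The vertices before, and after, the middle edge of the z-tree.
zBefore : List Step → ℕ → ℕ
zBefore w a = a + leftSteps w

zAfter : List Step → ℕ → ℕ
zAfter w b = length w ∸ leftSteps w + b

zTree-size : ∀ w a b → zSize w a b ≡ suc (suc (zBefore w a + zAfter w b))
zTree-size w a b = begin
  a + suc (suc (length w)) + b ≡⟨ cong (_+ b) (trans (+-suc a (suc (length w))) (cong suc (+-suc a (length w)))) ⟩
  suc (suc (a + length w + b)) ≡⟨ cong (λ x → suc (suc (a + x + b))) (sym (m+[n∸m]≡n (leftSteps≤length w))) ⟩
  suc (suc (a + (s + (length w ∸ s)) + b))
    ≡⟨ cong (suc ∘ suc) (solve 4 (λ a x y b → a :+ (x :+ y) :+ b := (a :+ x) :+ (y :+ b)) refl a s (length w ∸ s) b) ⟩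
  suc (suc (zBefore w a + zAfter w b)) ∎
  where
  open ≡-Reasoning
  open +-*-Solver
  s : ℕ
  s = leftSteps w

zTree-middle : ∀ w a b → zPattern w a b (zBefore w a) (suc (zBefore w a)) ≡ true
zTree-middle w a b =
  ZEdge⇒zPattern w a b (treeEdge (leftSteps w) (suc (leftSteps w)) refl (sym (+-suc a (leftSteps w))) (incEdges-middle w))

zTree-edgeCount : ∀ w a b → edgeCount (zTree w a b) ≡ suc (zBefore w a + zAfter w b)
zTree-edgeCount w a b = suc-injective (begin
  suc (edgeCount (zTree w a b))                         ≡⟨ +-comm 1 _ ⟩
  edgeCount (zTree w a b) + 1                           ≡⟨ cong (_+ 1) (edgeCount-restrict (zSize w a b) (zPattern w a b)) ⟩
  pairCount (zSize w a b) (zPattern w a b) + 1          ≡⟨ zTree-pairCount w a b ⟩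
  zSize w a b                                           ≡⟨ zTree-size w a b ⟩
  suc (suc (zBefore w a + zAfter w b))                  ∎)
  where open ≡-Reasoning

zTree-avoidedBy-frame : ∀ w a b n → ¬ Contains (zTree w a b) (restrict n (frame (zBefore w a) (zAfter w b) n))
zTree-avoidedBy-frame w a b n copy =
  frame-avoids (zBefore w a) (zAfter w b) n (zPattern w a b) (zTree-middle w a b)
    (Contains⇒Embeds (suc (zBefore w a + zAfter w b)) (zPattern w a b) frameGraph
      (subst (λ N → Contains (restrict N (zPattern w a b)) frameGraph) (zTree-size w a b) copy))
  where
  frameGraph : OGraph n
  frameGraph = restrict n (frame (zBefore w a) (zAfter w b) n)

zTree-upperBound : ∀ w a b n → zSize w a b ≤ n → (G : OGraph n) → ¬ Contains (zTree w a b) G →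
  edgeCount G ≤ exValue (suc (zBefore w a + zAfter w b)) n
zTree-upperBound w a b n N≤n G noCopy =
  subst (λ N → edgeCount G ≤ exValue (N ∸ 1) n) (zTree-size w a b)
    (zTree-exBound w a b n N≤n G (noCopy ∘ Embeds⇒Contains (zSize w a b) (zPattern w a b) G))

lemma2p3 : (w : List Step) (a b : ℕ) (n : ℕ) →
    edgeCount (zTree w a b) + 1 ≤ n →
    IsEx n (zTree w a b)
      ((edgeCount (zTree w a b) ∸ 1) * n ∸ (edgeCount (zTree w a b) C 2))
lemma2p3 w a b n k+1≤n =
  subst (λ k → IsEx n (zTree w a b) (exValue k n)) (sym (zTree-edgeCount w a b))
    ( (restrict n (frame p q n) , zTree-avoidedBy-frame w a b n , frame-edgeCount p q n p+q≤n)
    , zTree-upperBound w a b n N≤n )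
  where
  p : ℕ
  p = zBefore w a
  q : ℕ
  q = zAfter w b
  N≤n : zSize w a b ≤ n
  N≤n = subst (_≤ n) (trans (cong (_+ 1) (edgeCount-restrict (zSize w a b) (zPattern w a b))) (zTree-pairCount w a b)) k+1≤n
  p+q≤n : p + q ≤ n
  p+q≤n = ≤-trans (m≤n+m (p + q) 2) (subst (_≤ n) (zTree-size w a b) N≤n)
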